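{- For every $\epsilon > 0$ and every pattern-avoiding class $\mathcal{C}$ of permutations, there exists a sequence $(\sigma_n)_{n \in \mathbb{N}}$ of permutations, $\sigma_n$ of length $n$, such that $|\pi_n| = o(n^{0.5+\epsilon})$, where $\pi_n$ is a longest permutation belonging to $\mathcal{C}$ that is a pattern of $\sigma_n$.
   Context: A permutation of length $n$ is a bijection of $[1..n]$, written $\sigma_1\cdots\sigma_n$. A permutation $\pi$ of length $k$ is a pattern of $\sigma$ of length $n$ if there are indices $1 \le i_1<\cdots<i_k \le n$ with $\sigma_{i_\ell} < \sigma_{i_m}$ whenever $\pi_\ell < \pi_m$; otherwise $\sigma$ avoids $\pi$. A pattern-avoiding class is a class of the form $S(\tau_1,\ldots,\tau_m)$ ($m \ge 1$), the set of all permutations avoiding each of the patterns $\tau_1,\ldots,\tau_m$.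
   Formalization: The parameter ε ranges over the positive rationals, and so does the constant implicit in the little-o bound on the length of π_n. -}

module Defs where

open import Data.Nat using (ℕ)
open import Data.Fin using (Fin; _<_)
open import Data.Fin.Permutation using (Permutation′; _⟨$⟩ʳ_)
open import Data.Product using (Σ; _×_; proj₂)
open import Data.List using (List)
open import Data.List.Relation.Unary.All using (All)
open import Relation.Nullary using (¬_)

Perm : ℕ → Set
Perm n = Permutation′ n

_≼_ : {k n : ℕ} → Perm k → Perm n → Set
_≼_ {k} {n} π σ =
  Σ (Fin k → Fin n) λ e →
    (∀ i j → i < j → e i < e j) ×
    (∀ l m → (π ⟨$⟩ʳ l) < (π ⟨$⟩ʳ m) → (σ ⟨$⟩ʳ e l) < (σ ⟨$⟩ʳ e m))

Avoids : {k n : ℕ} → Perm n → Perm k → Set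
Avoids σ τ = ¬ (τ ≼ σ)

Pattern : Set
Pattern = Σ ℕ Perm

InClass : {n : ℕ} → List Pattern → Perm n → Set
InClass τs σ = All (λ τ → Avoids σ (proj₂ τ)) τs

{-# OPTIONS --safe #-}
module Submission where

-- Let σₙ send position i·s + j to value j·s + i for i, j < s = ⌊√n⌋ and fix the remaining
-- n − s² ≤ 2s positions. An occurrence of a pattern π in σₙ leaves a trace on the s × s
-- grid: the 0-1 matrix marking cell (i, j) when position i·s + j is used. Along rows the
-- positions increase and along columns the values increase, so if the trace contained the
-- permutation matrix of τ then π would contain τ. By the Marcus–Tardos theorem an s × s
-- matrix avoiding a permutation matrix has O(s) ones; hence every pattern of σₙ in S(τ, …)
-- has length O(s) + 2s = O(√n), which is o(n^(1/2 + ε)).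

open import Defs
open import Data.Bool using (Bool; true; false; T; not; _∧_)
open import Data.Bool.Properties using (T-≡; T-∧; T-not-≡)
open import Data.Empty using (⊥-elim)
open import Data.Fin as F using (Fin; zero; suc; toℕ)
open import Data.Fin.Permutation using (flip; permutation; _⟨$⟩ʳ_; _⟨$⟩ˡ_; inverseˡ)
open import Data.Fin.Properties as Fin
  using (toℕ-injective; toℕ<n; toℕ-fromℕ<; fromℕ<-toℕ; toℕ-combine; remQuot-combine; combine-remQuot)
open import Data.List using (List; []; _∷_)
open import Data.List.Relation.Unary.All using (_∷_)
open import Data.Nat
open import Data.Nat.Properties
open import Data.Nat.Tactic.RingSolver using (solve-∀)
open import Data.Product using (Σ; ∃; ∃₂; _×_; _,_; proj₁; proj₂)
open import Data.Sum using (_⊎_; inj₁; inj₂)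
open import Data.Unit using (tt)
open import Function using (_∘_; _∘′_)
open import Function.Bundles using (Equivalence; Injection)
open import Function.Properties.Inverse using (↔⇒↣)
open import Relation.Binary.Core using (_Preserves_⟶_)
open import Relation.Binary.Definitions using (tri<; tri≈; tri>)
open import Relation.Binary.PropositionalEquality
open import Relation.Nullary using (¬_; yes; no)
open import Relation.Nullary.Decidable using (Dec; ⌊_⌋; toWitness; fromWitness; T?)
open import Algebra.Properties.CommutativeSemigroup +-commutativeSemigroup using (interchange)
open import Algebra.Properties.CommutativeSemigroup *-commutativeSemigroup
  using () renaming (interchange to *-interchange)

open Equivalence using (to)

private
  variable
    d N : ℕ
    f g : ℕ → ℕ
    p : ℕ → Bool
    P Q : ℕ → Set

∑ : ℕ → (ℕ → ℕ) → ℕ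
∑ zero    f = 0
∑ (suc n) f = f 0 + ∑ n (f ∘ suc)

infixl 10 ∑
syntax ∑ n (λ i → e) = ∑[ i < n ] e

∑² : ℕ → (ℕ → ℕ → ℕ) → ℕ
∑² n h = ∑[ i < n ] ∑[ j < n ] h i j

∑-cong : ∀ n → (∀ {i} → i < n → f i ≡ g i) → ∑ n f ≡ ∑ n g
∑-cong zero    f≡g = refl
∑-cong (suc n) f≡g = cong₂ _+_ (f≡g z<s) (∑-cong n (f≡g ∘ s<s))

∑-mono-≤ : ∀ n → (∀ {i} → i < n → f i ≤ g i) → ∑ n f ≤ ∑ n g
∑-mono-≤ zero    f≤g = z≤n
∑-mono-≤ (suc n) f≤g = +-mono-≤ (f≤g z<s) (∑-mono-≤ n (f≤g ∘ s<s))

∑-distrib-+ : ∀ n → ∑[ i < n ] (f i + g i) ≡ ∑ n f + ∑ n g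
∑-distrib-+               zero    = refl
∑-distrib-+ {f = f} {g} (suc n) =
  trans (cong (f 0 + g 0 +_) (∑-distrib-+ n)) (interchange (f 0) (g 0) (∑ n (f ∘ suc)) (∑ n (g ∘ suc)))

*-distribˡ-∑ : ∀ c n → c * ∑ n f ≡ ∑[ i < n ] (c * f i)
*-distribˡ-∑         c zero    = *-zeroʳ c
*-distribˡ-∑ {f = f} c (suc n) = trans (*-distribˡ-+ c (f 0) _) (cong (c * f 0 +_) (*-distribˡ-∑ c n))

∑-const : ∀ n c → ∑[ _ < n ] c ≡ n * c
∑-const zero    c = refl
∑-const (suc n) c = cong (c +_) (∑-const n c)

∑-bounded : ∀ n {c} → (∀ {i} → i < n → f i ≤ c) → ∑ n f ≤ n * c
∑-bounded n {c} f≤c = ≤-trans (∑-mono-≤ n f≤c) (≤-reflexive (∑-const n c))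

∑-+ : ∀ a b → ∑ (a + b) f ≡ ∑ a f + ∑[ i < b ] f (a + i)
∑-+         zero    b = refl
∑-+ {f = f} (suc a) b = trans (cong (f 0 +_) (∑-+ a b)) (sym (+-assoc (f 0) _ _))

∑-* : ∀ N t → ∑ (N * t) f ≡ ∑[ I < N ] ∑[ a < t ] f (I * t + a)
∑-*         zero    t = refl
∑-* {f = f} (suc N) t = begin
  ∑ (t + N * t) f                                      ≡⟨ ∑-+ t (N * t) ⟩
  ∑ t f + ∑[ i < N * t ] f (t + i)                     ≡⟨ cong (∑ t f +_) (∑-* N t) ⟩
  ∑ t f + ∑[ I < N ] ∑[ a < t ] f (t + (I * t + a))    ≡⟨ cong (∑ t f +_) (∑-cong N λ {I} _ → ∑-cong t λ {a} _ → shift I a) ⟩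
  ∑ t f + ∑[ I < N ] ∑[ a < t ] f (suc I * t + a)      ∎
  where
  open ≡-Reasoning
  shift : ∀ I a → f (t + (I * t + a)) ≡ f (suc I * t + a)
  shift I a = cong f (sym (+-assoc t (I * t) a))

∑-comm : ∀ A B (h : ℕ → ℕ → ℕ) → ∑[ a < A ] ∑[ b < B ] h a b ≡ ∑[ b < B ] ∑[ a < A ] h a b
∑-comm zero    B h = sym (trans (∑-const B 0) (*-zeroʳ B))
∑-comm (suc A) B h = trans (cong (∑ B (h 0) +_) (∑-comm A B (h ∘ suc))) (sym (∑-distrib-+ B))

∑-monoˡ-≤ : ∀ {n n′} f → n ≤ n′ → ∑ n f ≤ ∑ n′ f
∑-monoˡ-≤ {n} {n′} f n≤n′ = begin
  ∑ n f                              ≤⟨ m≤m+n (∑ n f) _ ⟩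
  ∑ n f + ∑[ i < n′ ∸ n ] f (n + i)  ≡⟨ ∑-+ n (n′ ∸ n) ⟨
  ∑ (n + (n′ ∸ n)) f                 ≡⟨ cong (λ k → ∑ k f) (m+[n∸m]≡n n≤n′) ⟩
  ∑ n′ f                             ∎
  where open ≤-Reasoning

∑-*-∑ : ∀ A B (f g : ℕ → ℕ) → ∑[ a < A ] ∑[ b < B ] (f a * g b) ≡ ∑ A f * ∑ B g
∑-*-∑ A B f g = begin
  ∑[ a < A ] ∑[ b < B ] (f a * g b)  ≡⟨ ∑-cong A (λ {a} _ → sym (*-distribˡ-∑ (f a) B)) ⟩
  ∑[ a < A ] (f a * ∑ B g)           ≡⟨ ∑-cong A (λ _ → *-comm _ (∑ B g)) ⟩
  ∑[ a < A ] (∑ B g * f a)           ≡⟨ *-distribˡ-∑ (∑ B g) A ⟨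
  ∑ B g * ∑ A f                      ≡⟨ *-comm (∑ B g) _ ⟩
  ∑ A f * ∑ B g                      ∎
  where open ≡-Reasoning

∑-linear₃ : ∀ n a b c (x y z : ℕ → ℕ) →
  ∑[ i < n ] (a * x i + b * y i + c * z i) ≡ a * ∑ n x + b * ∑ n y + c * ∑ n z
∑-linear₃ zero    a b c x y z = sym (zeros a b c)
  where
  zeros : ∀ a b c → a * 0 + b * 0 + c * 0 ≡ 0
  zeros = solve-∀
∑-linear₃ (suc n) a b c x y z =
  trans (cong (a * x 0 + b * y 0 + c * z 0 +_) (∑-linear₃ n a b c (x ∘ suc) (y ∘ suc) (z ∘ suc)))
        (regroup a b c (x 0) (y 0) (z 0) (∑ n (x ∘ suc)) (∑ n (y ∘ suc)) (∑ n (z ∘ suc)))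
  where
  regroup : ∀ a b c x y z X Y Z →
    a * x + b * y + c * z + (a * X + b * Y + c * Z) ≡ a * (x + X) + b * (y + Y) + c * (z + Z)
  regroup = solve-∀

∑²-linear₃ : ∀ n a b c (x y z : ℕ → ℕ → ℕ) →
  ∑² n (λ i j → a * x i j + b * y i j + c * z i j) ≡ a * ∑² n x + b * ∑² n y + c * ∑² n z
∑²-linear₃ n a b c x y z =
  trans (∑-cong n λ {i} _ → ∑-linear₃ n a b c (x i) (y i) (z i)) (∑-linear₃ n a b c _ _ _)

𝟙 : Bool → ℕ
𝟙 true  = 1
𝟙 false = 0

𝟙≤1 : ∀ b → 𝟙 b ≤ 1
𝟙≤1 true  = ≤-refl
𝟙≤1 false = z≤n

𝟙-true : ∀ {b} → T b → 𝟙 b ≡ 1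
𝟙-true {true} _ = refl

count : ℕ → (ℕ → Bool) → ℕ
count n p = ∑[ i < n ] 𝟙 (p i)

count≤n : ∀ n p → count n p ≤ n
count≤n n p = subst (count n p ≤_) (*-identityʳ n) (∑-bounded n (λ {i} _ → 𝟙≤1 (p i)))

count≡0 : ∀ n → (∀ {i} → i < n → ¬ T (p i)) → count n p ≡ 0
count≡0 n ¬p = trans (∑-cong n (λ i<n → 𝟙-false (¬p i<n))) (trans (∑-const n 0) (*-zeroʳ n))
  where
  𝟙-false : ∀ {b} → ¬ T b → 𝟙 b ≡ 0
  𝟙-false {false} _  = refl
  𝟙-false {true}  ¬b = ⊥-elim (¬b tt)

count-suc-true : ∀ n p → T (p 0) → count (suc n) p ≡ suc (count n (p ∘ suc))
count-suc-true n p p₀ = cong (_+ count n (p ∘ suc)) (𝟙-true p₀)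

count-suc-false : ∀ n p → p 0 ≡ false → count (suc n) p ≡ count n (p ∘ suc)
count-suc-false n p p₀ = cong (λ b → 𝟙 b + count n (p ∘ suc)) p₀

count-partition : ∀ N (S B : ℕ → Bool) →
  count N S ≡ count N (λ I → S I ∧ B I) + count N (λ I → S I ∧ not (B I))
count-partition N S B =
  trans (∑-cong {g = λ I → 𝟙 (S I ∧ B I) + 𝟙 (S I ∧ not (B I))} N λ {I} _ → 𝟙-split (S I) (B I))
        (∑-distrib-+ N)
  where
  𝟙-split : ∀ a b → 𝟙 a ≡ 𝟙 (a ∧ b) + 𝟙 (a ∧ not b)
  𝟙-split true  true  = refl
  𝟙-split true  false = refl
  𝟙-split false _     = refl

record Selection (d N : ℕ) (P : ℕ → Set) : Set where
  field
    point      : Fin d → ℕ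
    increasing : point Preserves F._<_ ⟶ _<_
    bounded    : ∀ v → point v < N
    holds      : ∀ v → P (point v)

open Selection

Selection-empty : Selection 0 N P
Selection-empty = record { point = λ () ; increasing = λ {} ; bounded = λ () ; holds = λ () }

Selection-map : (∀ {x} → P x → Q x) → Selection d N P → Selection d N Q
Selection-map P⇒Q S = record
  { point = point S ; increasing = increasing S
  ; bounded = bounded S ; holds = P⇒Q ∘ holds S }

Selection-tail : Selection (suc d) N P → Selection d N P
Selection-tail S = record
  { point = point S ∘ suc ; increasing = increasing S ∘ s<s
  ; bounded = bounded S ∘ suc ; holds = holds S ∘ suc }

Selection-shift : Selection d N (P ∘ suc) → Selection d (suc N) P
Selection-shift S = record
  { point = suc ∘ point S ; increasing = s<s ∘ increasing S
  ; bounded = s<s ∘ bounded S ; holds = holds S }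

Selection-unshift : (S : Selection d (suc N) P) → (∀ v → 0 < point S v) → Selection d N (P ∘ suc)
Selection-unshift {P = P} S pos = record
  { point      = pred ∘ point S
  ; increasing = λ {u} u<v → pred-mono-< {{>-nonZero (pos u)}} (increasing S u<v)
  ; bounded    = λ v → pred-mono-< {{>-nonZero (pos v)}} (bounded S v)
  ; holds      = λ v → subst P (sym (suc-pred (point S v) {{>-nonZero (pos v)}})) (holds S v)
  }

Selection-cons : P 0 → Selection d N (P ∘ suc) → Selection (suc d) (suc N) P
Selection-cons {P = P} {d} {N} P0 S = record { point = pt ; increasing = inc ; bounded = bd ; holds = hd }
  where
  pt : Fin (suc d) → ℕ
  pt zero    = 0
  pt (suc v) = suc (point S v)
  inc : pt Preserves F._<_ ⟶ _<_
  inc {zero}  {suc _} _         = z<s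
  inc {suc _} {suc _} (s<s u<v) = s<s (increasing S u<v)
  bd : ∀ v → pt v < suc N
  bd zero    = z<s
  bd (suc v) = s<s (bounded S v)
  hd : ∀ v → P (pt v)
  hd zero    = P0
  hd (suc v) = holds S v

≤count⇒Selection : ∀ d N p → d ≤ count N p → Selection d N (T ∘ p)
≤count⇒Selection zero    N       p _ = Selection-empty
≤count⇒Selection (suc d) (suc N) p d<count with p 0 in p₀
... | true  = Selection-cons (subst T (sym p₀) tt) (≤count⇒Selection d N (p ∘ suc) (s≤s⁻¹ d<count))
... | false = Selection-shift (≤count⇒Selection (suc d) N (p ∘ suc) d<count)

Selection⇒≤count : ∀ d N p → Selection d N (T ∘ p) → d ≤ count N p
Selection⇒≤count zero    N       p S = z≤n
Selection⇒≤count (suc d) zero    p S with () ← bounded S zero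
Selection⇒≤count (suc d) (suc N) p S with point S zero in point₀
... | zero  = begin
  suc d                  ≤⟨ s≤s (Selection⇒≤count d N (p ∘ suc) rest) ⟩
  1 + count N (p ∘ suc)  ≡⟨ count-suc-true N p (subst (T ∘ p) point₀ (holds S zero)) ⟨
  count (suc N) p        ∎
  where
  open ≤-Reasoning
  pos : ∀ v → 0 < point S (suc v)
  pos v = subst (_< point S (suc v)) point₀ (increasing S z<s)
  rest : Selection d N (T ∘ p ∘ suc)
  rest = Selection-unshift (Selection-tail S) pos
... | suc _ = ≤-trans (Selection⇒≤count (suc d) N (p ∘ suc) (Selection-unshift S pos)) (m≤n+m _ (𝟙 (p 0)))
  where
  pos : ∀ v → 0 < point S v
  pos zero    = subst (0 <_) (sym point₀) z<s
  pos (suc v) = <-trans (pos zero) (increasing S z<s)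

m+m<n+o⇒m<n⊎m<o : ∀ {m n o} → m + m < n + o → m < n ⊎ m < o
m+m<n+o⇒m<n⊎m<o {m} {n} {o} lt with m <? n | m <? o
... | yes m<n | _       = inj₁ m<n
... | no  _   | yes m<o = inj₂ m<o
... | no  m≮n | no  m≮o = ⊥-elim (<⇒≱ lt (+-mono-≤ (≮⇒≥ m≮n) (≮⇒≥ m≮o)))

-- Pigeonhole by halving: split the rows selected by S according to whether they mark (by Q)
-- column 0; one half still has more than m · 2^(w-1) rows.
common-columns : ∀ w d m N (S : ℕ → Bool) (Q : ℕ → ℕ → Bool) →
  (∀ {I} → T (S I) → d ≤ count w (Q I)) → m * 2 ^ w < count N S →
  Σ (Selection m N (T ∘ S)) λ rows → Selection d w (λ b → ∀ l → T (Q (point rows l) b))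
common-columns w zero m N S Q _ many =
  ≤count⇒Selection m N S (≤-trans (m≤m*n m (2 ^ w) {{m^n≢0 2 w}}) (<⇒≤ many)) , Selection-empty
common-columns zero (suc d) m N S Q marks many =
  ⊥-elim (<⇒≱ many (≤-trans (≤-reflexive (count≡0 N λ _ SI → <⇒≱ (marks SI) z≤n)) z≤n))
common-columns (suc w) (suc d) m N S Q marks many
  with m+m<n+o⇒m<n⊎m<o (subst₂ _<_ (halves m (2 ^ w)) (count-partition N S (λ I → Q I 0)) many)
  where
  halves : ∀ m x → m * (2 * x) ≡ m * x + m * x
  halves m x = trans (cong (m *_) (cong (x +_) (+-identityʳ x))) (*-distribˡ-+ m x x)
... | inj₁ many₀ =
  let rows , cols = common-columns w d m N _ (λ I b → Q I (suc b)) marks₀ many₀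
  in  Selection-map (λ SI∧QI0 → proj₁ (to T-∧ SI∧QI0)) rows ,
      Selection-cons (λ l → proj₂ (to (T-∧ {S (point rows l)}) (holds rows l))) cols
  where
  marks₀ : ∀ {I} → T (S I ∧ Q I 0) → d ≤ count w (Q I ∘ suc)
  marks₀ SI∧QI0 = let SI , QI0 = to T-∧ SI∧QI0 in
    s≤s⁻¹ (subst (suc d ≤_) (count-suc-true w (Q _) QI0) (marks SI))
... | inj₂ many₁ =
  let rows , cols = common-columns w (suc d) m N _ (λ I b → Q I (suc b)) marks₁ many₁
  in  Selection-map (λ SI∧¬QI0 → proj₁ (to T-∧ SI∧¬QI0)) rows , Selection-shift cols
  where
  marks₁ : ∀ {I} → T (S I ∧ not (Q I 0)) → suc d ≤ count w (Q I ∘ suc)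
  marks₁ SI∧¬QI0 = let SI , ¬QI0 = to T-∧ SI∧¬QI0 in
    subst (suc d ≤_) (count-suc-false w (Q _) (to T-not-≡ ¬QI0)) (marks SI)

-- 0-1 matrices and pattern containment

Matrix : Set
Matrix = ℕ → ℕ → Bool

transpose : Matrix → Matrix
transpose M i j = M j i

weight : ℕ → Matrix → ℕ
weight s M = ∑² s (λ i j → 𝟙 (M i j))

record Contains {m} (τ : Perm m) (M : Matrix) : Set where
  field
    row            : Fin m → ℕ
    col            : Fin m → ℕ
    row-increasing : row Preserves F._<_ ⟶ _<_
    col-increasing : col Preserves F._<_ ⟶ _<_
    hit            : ∀ l → T (M (row l) (col (τ ⟨$⟩ʳ l)))

open Contains

Contains-transpose : ∀ {m} {τ : Perm m} {M} → Contains (flip τ) (transpose M) → Contains τ M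
Contains-transpose {τ = τ} {M} occ = record
  { row            = col occ
  ; col            = row occ
  ; row-increasing = col-increasing occ
  ; col-increasing = row-increasing occ
  ; hit            = λ l → subst (λ k → T (M (col occ k) (row occ (τ ⟨$⟩ʳ l)))) (inverseˡ τ)
                                 (hit occ (τ ⟨$⟩ʳ l))
  }

lex-< : ∀ t {I I′ a a′} → I < I′ → a < t → I * t + a < I′ * t + a′
lex-< t {I} {I′} {a} {a′} I<I′ a<t = begin-strict
  I * t + a      <⟨ +-monoʳ-< (I * t) a<t ⟩
  I * t + t      ≡⟨ +-comm (I * t) t ⟩
  suc I * t      ≤⟨ *-monoˡ-≤ t I<I′ ⟩
  I′ * t         ≤⟨ m≤m+n (I′ * t) a′ ⟩
  I′ * t + a′    ∎
  where open ≤-Reasoning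

rowUsed : ℕ → Matrix → ℕ → Bool
rowUsed t X a = ⌊ anyUpTo? (λ b → T? (X a b)) t ⌋

colUsed : ℕ → Matrix → ℕ → Bool
colUsed t X = rowUsed t (transpose X)

rowUsed-intro : ∀ t X {a b} → b < t → T (X a b) → T (rowUsed t X a)
rowUsed-intro t X b<t Xab = fromWitness (_ , b<t , Xab)

rowUsed-witness : ∀ t X {a} → T (rowUsed t X a) → ∃ λ b → b < t × T (X a b)
rowUsed-witness t X = toWitness

weight≤square : ∀ t X → weight t X ≤ t * t
weight≤square t X = ∑-bounded t λ {a} _ →
  subst (∑[ b < t ] 𝟙 (X a b) ≤_) (*-identityʳ t) (∑-bounded t λ {b} _ → 𝟙≤1 (X a b))

weight≤rows*cols : ∀ t X → weight t X ≤ count t (rowUsed t X) * count t (colUsed t X)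
weight≤rows*cols t X = begin
  weight t X
    ≤⟨ ∑-mono-≤ t (λ a<t → ∑-mono-≤ t (used a<t)) ⟩
  ∑[ a < t ] ∑[ b < t ] (𝟙 (rowUsed t X a) * 𝟙 (colUsed t X b))
    ≡⟨ ∑-*-∑ t t _ _ ⟩
  count t (rowUsed t X) * count t (colUsed t X)
    ∎
  where
  open ≤-Reasoning
  used : ∀ {a b} → a < t → b < t → 𝟙 (X a b) ≤ 𝟙 (rowUsed t X a) * 𝟙 (colUsed t X b)
  used {a} {b} a<t b<t with X a b in Xab
  ... | false = z≤n
  ... | true  = ≤-reflexive (sym (cong₂ _*_ (𝟙-true (rowUsed-intro t X b<t hitᵃᵇ))
                                            (𝟙-true (rowUsed-intro t (transpose X) a<t hitᵃᵇ))))
    where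
    hitᵃᵇ : T (X a b)
    hitᵃᵇ = subst T (sym Xab) tt

block : ℕ → Matrix → ℕ → ℕ → Matrix
block t M I J a b = M (I * t + a) (J * t + b)

contract : ℕ → Matrix → Matrix
contract t M I J = ⌊ anyUpTo? (λ a → T? (rowUsed t (block t M I J) a)) t ⌋

wide : ℕ → ℕ → Matrix → ℕ → ℕ → Bool
wide m t M I J = m ≤ᵇ count t (colUsed t (block t M I J))

tall : ℕ → ℕ → Matrix → ℕ → ℕ → Bool
tall m t M I J = wide m t (transpose M) J I

weight-blocks : ∀ N t M → weight (N * t) M ≡ ∑² N (λ I J → weight t (block t M I J))
weight-blocks N t M = begin
  weight (N * t) M
    ≡⟨ ∑-* N t ⟩
  ∑[ I < N ] ∑[ a < t ] ∑[ j < N * t ] 𝟙 (M (I * t + a) j)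
    ≡⟨ ∑-cong N (λ _ → ∑-cong t λ _ → ∑-* N t) ⟩
  ∑[ I < N ] ∑[ a < t ] ∑[ J < N ] ∑[ b < t ] 𝟙 (block t M I J a b)
    ≡⟨ ∑-cong N (λ {I} _ → ∑-comm t N (λ a J → ∑[ b < t ] 𝟙 (block t M I J a b))) ⟩
  ∑² N (λ I J → weight t (block t M I J))
    ∎
  where open ≡-Reasoning

contract-witness : ∀ t M I J → T (contract t M I J) → ∃₂ λ a b → a < t × b < t × T (block t M I J a b)
contract-witness t M I J nonzero =
  let a , a<t , used = toWitness nonzero
      b , b<t , Mab  = rowUsed-witness t (block t M I J) used
  in  a , b , a<t , b<t , Mab

Contains-contract : ∀ {m} {τ : Perm m} t {M} → Contains τ (contract t M) → Contains τ M
Contains-contract {m} {τ} t {M} occ = record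
  { row            = λ l → row occ l * t + a l
  ; col            = λ v → col occ v * t + b (τ ⟨$⟩ˡ v)
  ; row-increasing = λ {i} i<j → lex-< t (row-increasing occ i<j) (a<t i)
  ; col-increasing = λ {u} u<v → lex-< t (col-increasing occ u<v) (b<t (τ ⟨$⟩ˡ u))
  ; hit            = λ l → subst (λ k → T (M (row occ l * t + a l) (col occ (τ ⟨$⟩ʳ l) * t + b k)))
                                 (sym (inverseˡ τ)) (Mab l)
  }
  where
  X : Fin m → Matrix
  X l = block t M (row occ l) (col occ (τ ⟨$⟩ʳ l))
  cell : ∀ l → ∃₂ λ a b → a < t × b < t × T (X l a b)
  cell l = contract-witness t M (row occ l) (col occ (τ ⟨$⟩ʳ l)) (hit occ l)
  a b : Fin m → ℕ
  a l = proj₁ (cell l)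
  b l = proj₁ (proj₂ (cell l))
  a<t : ∀ l → a l < t
  a<t l = proj₁ (proj₂ (proj₂ (cell l)))
  b<t : ∀ l → b l < t
  b<t l = proj₁ (proj₂ (proj₂ (proj₂ (cell l))))
  Mab : ∀ l → T (X l (a l) (b l))
  Mab l = proj₂ (proj₂ (proj₂ (proj₂ (cell l))))

-- m wide blocks in one block column that share m used columns would contain τ.
count-wide≤ : ∀ {m} (τ : Perm m) t M N J → ¬ Contains τ M →
  count N (λ I → wide m t M I J) ≤ m * 2 ^ t
count-wide≤ {m} τ t M N J τ⊈M with count N (λ I → wide m t M I J) ≤? m * 2 ^ t
... | yes few  = few
... | no  many = ⊥-elim (τ⊈M occurrence)
  where
  common : Σ (Selection m N (T ∘ λ I → wide m t M I J)) λ rows →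
             Selection m t (λ b → ∀ l → T (colUsed t (block t M (point rows l) J) b))
  common = common-columns t m m N (λ I → wide m t M I J) (λ I → colUsed t (block t M I J))
                          (λ {I} → ≤ᵇ⇒≤ m _) (≰⇒> many)
  rows : Selection m N (T ∘ λ I → wide m t M I J)
  rows = proj₁ common
  cols : Selection m t (λ b → ∀ l → T (colUsed t (block t M (point rows l) J) b))
  cols = proj₂ common
  cell : ∀ l → ∃ λ a → a < t × T (block t M (point rows l) J a (point cols (τ ⟨$⟩ʳ l)))
  cell l = rowUsed-witness t (transpose (block t M (point rows l) J)) (holds cols (τ ⟨$⟩ʳ l) l)
  occurrence : Contains τ M
  occurrence = record
    { row            = λ l → point rows l * t + proj₁ (cell l)
    ; col            = λ v → J * t + point cols v
    ; row-increasing = λ {i} i<j → lex-< t (increasing rows i<j) (proj₁ (proj₂ (cell i)))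
    ; col-increasing = λ u<v → +-monoʳ-< (J * t) (increasing cols u<v)
    ; hit            = λ l → proj₂ (proj₂ (cell l))
    }

weight-thin-block≤ : ∀ m t M I J → wide m t M I J ≡ false → tall m t M I J ≡ false →
  weight t (block t M I J) ≤ pred m * pred m * 𝟙 (contract t M I J)
weight-thin-block≤ m t M I J ¬wide ¬tall with contract t M I J in nonzero
... | true  = begin
  weight t X                                     ≤⟨ weight≤rows*cols t X ⟩
  count t (rowUsed t X) * count t (colUsed t X)  ≤⟨ *-mono-≤ (fewer ¬tall) (fewer ¬wide) ⟩
  pred m * pred m                                ≡⟨ *-identityʳ _ ⟨
  pred m * pred m * 1                            ∎
  where
  open ≤-Reasoning
  X : Matrix
  X = block t M I J
  fewer : ∀ {c} → (m ≤ᵇ c) ≡ false → c ≤ pred m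
  fewer m≰ᵇc = <⇒≤pred {n = m} (≰⇒> λ m≤c → subst T m≰ᵇc (≤⇒≤ᵇ m≤c))
... | false = begin
  weight t X                                     ≤⟨ weight≤rows*cols t X ⟩
  count t (rowUsed t X) * count t (colUsed t X)  ≡⟨ cong (_* count t (colUsed t X)) no-rows ⟩
  0                                              ≡⟨ *-zeroʳ (pred m * pred m) ⟨
  pred m * pred m * 0                            ∎
  where
  open ≤-Reasoning
  X : Matrix
  X = block t M I J
  no-rows : count t (rowUsed t X) ≡ 0
  no-rows = count≡0 t λ a<t used → subst T nonzero (fromWitness (_ , a<t , used))

weight-block≤ : ∀ m t M I J → weight t (block t M I J) ≤
  pred m * pred m * 𝟙 (contract t M I J) + t * t * 𝟙 (wide m t M I J) + t * t * 𝟙 (tall m t M I J)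
weight-block≤ m t M I J = bound (wide m t M I J) (tall m t M I J) refl refl
  where
  X : Matrix
  X = block t M I J
  thin : ℕ
  thin = pred m * pred m * 𝟙 (contract t M I J)
  square : weight t X ≤ t * t * 1
  square = ≤-trans (weight≤square t X) (≤-reflexive (sym (*-identityʳ (t * t))))
  bound : ∀ w h → wide m t M I J ≡ w → tall m t M I J ≡ h →
    weight t X ≤ thin + t * t * 𝟙 w + t * t * 𝟙 h
  bound true  h     _     _     = ≤-trans square (≤-trans (m≤n+m _ thin) (m≤m+n _ (t * t * 𝟙 h)))
  bound false true  _     _     = ≤-trans square (m≤n+m _ (thin + t * t * 0))
  bound false false ¬wide ¬tall =
    ≤-trans (weight-thin-block≤ m t M I J ¬wide ¬tall) (≤-trans (m≤m+n _ _) (m≤m+n _ _))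

weight-monoˡ-≤ : ∀ M {s s′} → s ≤ s′ → weight s M ≤ weight s′ M
weight-monoˡ-≤ M {s} {s′} s≤s′ =
  ≤-trans (∑-mono-≤ s λ {i} _ → ∑-monoˡ-≤ (λ j → 𝟙 (M i j)) s≤s′)
          (∑-monoˡ-≤ (λ i → ∑[ j < s′ ] 𝟙 (M i j)) s≤s′)

between-powers : ∀ t → 2 ≤ t → ∀ s → ∃ λ j → suc s ≤ t ^ j × t ^ j ≤ t * suc s
between-powers t 2≤t zero    =
  0 , ≤-refl , ≤-trans (≤-trans (s≤s z≤n) 2≤t) (≤-reflexive (sym (*-identityʳ t)))
between-powers t 2≤t (suc s) with between-powers t 2≤t s
... | j , s<tʲ , tʲ≤ts with suc (suc s) ≤? t ^ j
...   | yes ss≤tʲ = j , ss≤tʲ , ≤-trans tʲ≤ts (*-monoʳ-≤ t (n≤1+n (suc s)))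
...   | no  ss≰tʲ = suc j , ss≤ttʲ , *-monoʳ-≤ t (≤-trans tʲ≤s (n≤1+n (suc s)))
  where
  tʲ≤s : t ^ j ≤ suc s
  tʲ≤s = s≤s⁻¹ (≰⇒> ss≰tʲ)
  ss≤ttʲ : suc (suc s) ≤ t * t ^ j
  ss≤ttʲ = begin
    suc (suc s)    ≤⟨ s≤s (m≤n+m (suc s) s) ⟩
    suc s + suc s  ≡⟨ cong (suc s +_) (+-identityʳ (suc s)) ⟨
    2 * suc s      ≤⟨ *-monoˡ-≤ (suc s) 2≤t ⟩
    t * suc s      ≡⟨ cong (t *_) (≤-antisym tʲ≤s s<tʲ) ⟨
    t * t ^ j      ∎
    where open ≤-Reasoning

-- The Marcus–Tardos theorem

-- Let f(s) be the largest weight of an s × s matrix avoiding τ, and cut a matrix of side t·s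
-- into t × t blocks. At most W blocks per block column are wide and at most W per block row
-- are tall; every other block has at most m² ones and is a one of the contracted matrix,
-- which avoids τ as well. Hence f(t·s) ≤ m² f(s) + 2 t² W s, and t = m² + 2 makes
-- f(tʲ) ≤ K tʲ go through by induction on j.
module MarcusTardos {m : ℕ} (τ : Perm (suc m)) where

  t : ℕ
  t = 2 + m * m

  W : ℕ
  W = suc m * 2 ^ t

  K : ℕ
  K = t * t * W

  1≤K : 1 ≤ K
  1≤K = ≤-trans (m^n>0 2 t) (≤-trans (m≤n*m (2 ^ t) (suc m)) (m≤n*m W (t * t)))

  weight-t^j≤ : ∀ j M → ¬ Contains τ M → weight (t ^ j) M ≤ K * t ^ j
  weight-t^j≤ zero    M _    =
    ≤-trans (weight≤square 1 M) (≤-trans 1≤K (≤-reflexive (sym (*-identityʳ K))))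
  weight-t^j≤ (suc j) M τ⊈M = begin
    weight (t * s) M
      ≡⟨ cong (λ n → weight n M) (*-comm t s) ⟩
    weight (s * t) M
      ≡⟨ weight-blocks s t M ⟩
    ∑² s (λ I J → weight t (block t M I J))
      ≤⟨ ∑-mono-≤ s (λ {I} _ → ∑-mono-≤ s λ {J} _ → weight-block≤ (suc m) t M I J) ⟩
    ∑² s (λ I J → m * m * nonzero I J + t * t * isWide I J + t * t * isTall I J)
      ≡⟨ ∑²-linear₃ s (m * m) (t * t) (t * t) nonzero isWide isTall ⟩
    m * m * ∑² s nonzero + t * t * ∑² s isWide + t * t * ∑² s isTall
      ≤⟨ +-mono-≤ (+-mono-≤ (*-monoʳ-≤ (m * m) contracted) (*-monoʳ-≤ (t * t) wide-blocks))
                  (*-monoʳ-≤ (t * t) tall-blocks) ⟩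
    m * m * (K * s) + t * t * (s * W) + t * t * (s * W)
      ≡⟨ recurrence (m * m) W s ⟩
    K * (t * s)
      ∎
    where
    open ≤-Reasoning
    s : ℕ
    s = t ^ j
    nonzero isWide isTall : ℕ → ℕ → ℕ
    nonzero I J = 𝟙 (contract t M I J)
    isWide  I J = 𝟙 (wide (suc m) t M I J)
    isTall  I J = 𝟙 (tall (suc m) t M I J)
    contracted : ∑² s nonzero ≤ K * s
    contracted = weight-t^j≤ j (contract t M) (τ⊈M ∘ Contains-contract t)
    wide-blocks : ∑² s isWide ≤ s * W
    wide-blocks =
      ≤-trans (≤-reflexive (∑-comm s s isWide)) (∑-bounded s λ {J} _ → count-wide≤ τ t M s J τ⊈M)
    tall-blocks : ∑² s isTall ≤ s * W
    tall-blocks =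
      ∑-bounded s λ {I} _ → count-wide≤ (flip τ) t (transpose M) s I (τ⊈M ∘ Contains-transpose)
    recurrence : ∀ x W s → let t = 2 + x in
      x * (t * t * W * s) + t * t * (s * W) + t * t * (s * W) ≡ t * t * W * (t * s)
    recurrence = solve-∀

  marcus-tardos : ∀ s M → ¬ Contains τ M → weight s M ≤ K * t * s
  marcus-tardos zero    M _    = z≤n
  marcus-tardos (suc s) M τ⊈M with between-powers t (s≤s (s≤s z≤n)) s
  ... | j , s≤tʲ , tʲ≤ts = begin
    weight (suc s) M  ≤⟨ weight-monoˡ-≤ M s≤tʲ ⟩
    weight (t ^ j) M  ≤⟨ weight-t^j≤ j M τ⊈M ⟩
    K * t ^ j         ≤⟨ *-monoʳ-≤ K tʲ≤ts ⟩
    K * (t * suc s)   ≡⟨ *-assoc K t (suc s) ⟨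
    K * t * suc s     ∎
    where open ≤-Reasoning

-- The grid permutation

⌊√_⌋ : ℕ → ℕ
⌊√ zero  ⌋ = 0
⌊√ suc n ⌋ with suc ⌊√ n ⌋ * suc ⌊√ n ⌋ ≤? suc n
... | yes _ = suc ⌊√ n ⌋
... | no  _ = ⌊√ n ⌋

⌊√n⌋²≤n : ∀ n → ⌊√ n ⌋ * ⌊√ n ⌋ ≤ n
⌊√n⌋²≤n zero = z≤n
⌊√n⌋²≤n (suc n) with suc ⌊√ n ⌋ * suc ⌊√ n ⌋ ≤? suc n
... | yes r²≤n = r²≤n
... | no  _    = m≤n⇒m≤1+n (⌊√n⌋²≤n n)

n<[1+⌊√n⌋]² : ∀ n → n < suc ⌊√ n ⌋ * suc ⌊√ n ⌋
n<[1+⌊√n⌋]² zero = z<s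
n<[1+⌊√n⌋]² (suc n) with suc ⌊√ n ⌋ * suc ⌊√ n ⌋ ≤? suc n
... | yes _    = ≤-<-trans (n<[1+⌊√n⌋]² n) (*-mono-< (n<1+n (suc ⌊√ n ⌋)) (n<1+n (suc ⌊√ n ⌋)))
... | no  r²≰n = ≰⇒> r²≰n

n∸⌊√n⌋²≤2⌊√n⌋ : ∀ n → n ∸ ⌊√ n ⌋ * ⌊√ n ⌋ ≤ ⌊√ n ⌋ + ⌊√ n ⌋
n∸⌊√n⌋²≤2⌊√n⌋ n = begin
  n ∸ r * r                ≤⟨ ∸-monoˡ-≤ (r * r) n≤r²+2r ⟩
  r * r + (r + r) ∸ r * r  ≡⟨ m+n∸m≡n (r * r) (r + r) ⟩
  r + r                    ∎
  where
  open ≤-Reasoning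
  r : ℕ
  r = ⌊√ n ⌋
  square-suc : ∀ r → suc r * suc r ≡ suc (r * r + (r + r))
  square-suc = solve-∀
  n≤r²+2r : n ≤ r * r + (r + r)
  n≤r²+2r = s≤s⁻¹ (subst (n <_) (square-suc r) (n<[1+⌊√n⌋]² n))

transposeCell : ∀ s → Fin (s * s) → Fin (s * s)
transposeCell s c = F.combine (proj₂ (F.remQuot {s} s c)) (proj₁ (F.remQuot {s} s c))

transposeCell-combine : ∀ {s} (i j : Fin s) → transposeCell s (F.combine i j) ≡ F.combine j i
transposeCell-combine {s} i j = cong (λ (a , b) → F.combine b a) (remQuot-combine {s} {s} i j)

transposeCell-involutive : ∀ s (c : Fin (s * s)) → transposeCell s (transposeCell s c) ≡ c
transposeCell-involutive s c =
  trans (transposeCell-combine (proj₂ (F.remQuot {s} s c)) (proj₁ (F.remQuot {s} s c))) (combine-remQuot {s} s c)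

gridTranspose : ℕ → ℕ → ℕ
gridTranspose s p with p <? s * s
... | yes p<s² = toℕ (transposeCell s (F.fromℕ< p<s²))
... | no  _    = p

gridTranspose-toℕ : ∀ s (c : Fin (s * s)) → gridTranspose s (toℕ c) ≡ toℕ (transposeCell s c)
gridTranspose-toℕ s c with toℕ c <? s * s
... | yes c<s² = cong (toℕ ∘ transposeCell s) (fromℕ<-toℕ c c<s²)
... | no  c≮s² = ⊥-elim (c≮s² (toℕ<n c))

gridTranspose-outside : ∀ s {p} → ¬ p < s * s → gridTranspose s p ≡ p
gridTranspose-outside s {p} p≮s² with p <? s * s
... | yes p<s² = ⊥-elim (p≮s² p<s²)
... | no  _    = refl

gridTranspose-involutive : ∀ s p → gridTranspose s (gridTranspose s p) ≡ p
gridTranspose-involutive s p with p <? s * s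
... | no  p≮s² = gridTranspose-outside s p≮s²
... | yes p<s² = begin
  gridTranspose s (toℕ (transposeCell s c))  ≡⟨ gridTranspose-toℕ s (transposeCell s c) ⟩
  toℕ (transposeCell s (transposeCell s c))  ≡⟨ cong toℕ (transposeCell-involutive s c) ⟩
  toℕ c                                      ≡⟨ toℕ-fromℕ< p<s² ⟩
  p                                          ∎
  where
  open ≡-Reasoning
  c : Fin (s * s)
  c = F.fromℕ< p<s²

gridTranspose-< : ∀ s {n p} → s * s ≤ n → p < n → gridTranspose s p < n
gridTranspose-< s {n} {p} s²≤n p<n with p <? s * s
... | yes p<s² = ≤-trans (toℕ<n (transposeCell s (F.fromℕ< p<s²))) s²≤n
... | no  _    = p<n

gridTranspose-cell : ∀ {s i j} → i < s → j < s → gridTranspose s (i * s + j) ≡ j * s + i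
gridTranspose-cell {s} {i} {j} i<s j<s = begin
  gridTranspose s (i * s + j)              ≡⟨ cong (gridTranspose s) (toℕ-combine-fromℕ< i<s j<s) ⟨
  gridTranspose s (toℕ (F.combine i′ j′))  ≡⟨ gridTranspose-toℕ s (F.combine i′ j′) ⟩
  toℕ (transposeCell s (F.combine i′ j′))  ≡⟨ cong toℕ (transposeCell-combine i′ j′) ⟩
  toℕ (F.combine j′ i′)                    ≡⟨ toℕ-combine-fromℕ< j<s i<s ⟩
  j * s + i                                ∎
  where
  open ≡-Reasoning
  i′ j′ : Fin s
  i′ = F.fromℕ< i<s
  j′ = F.fromℕ< j<s
  toℕ-combine-fromℕ< : ∀ {a b} (a<s : a < s) (b<s : b < s) →
    toℕ (F.combine (F.fromℕ< a<s) (F.fromℕ< b<s)) ≡ a * s + b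
  toℕ-combine-fromℕ< {a} {b} a<s b<s = begin
    toℕ (F.combine (F.fromℕ< a<s) (F.fromℕ< b<s))  ≡⟨ toℕ-combine (F.fromℕ< a<s) (F.fromℕ< b<s) ⟩
    s * toℕ (F.fromℕ< a<s) + toℕ (F.fromℕ< b<s)    ≡⟨ cong₂ (λ x y → s * x + y)
                                                         (toℕ-fromℕ< a<s) (toℕ-fromℕ< b<s) ⟩
    s * a + b                                      ≡⟨ cong (_+ b) (*-comm s a) ⟩
    a * s + b                                      ∎

gridPerm : (n : ℕ) → Perm n
gridPerm n = permutation σ σ σ-involutive σ-involutive
  where
  s : ℕ
  s = ⌊√ n ⌋
  σ : Fin n → Fin n
  σ x = F.fromℕ< (gridTranspose-< s (⌊√n⌋²≤n n) (toℕ<n x))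
  σ-involutive : ∀ x → σ (σ x) ≡ x
  σ-involutive x = toℕ-injective (begin
    toℕ (σ (σ x))                            ≡⟨ toℕ-fromℕ< _ ⟩
    gridTranspose s (toℕ (σ x))              ≡⟨ cong (gridTranspose s) (toℕ-fromℕ< _) ⟩
    gridTranspose s (gridTranspose s (toℕ x)) ≡⟨ gridTranspose-involutive s (toℕ x) ⟩
    toℕ x                                    ∎)
    where open ≡-Reasoning

toℕ-gridPerm : ∀ n x → toℕ (gridPerm n ⟨$⟩ʳ x) ≡ gridTranspose ⌊√ n ⌋ (toℕ x)
toℕ-gridPerm n x = toℕ-fromℕ< _

<-reflected : ∀ {A : Set} {n n′} (f : A → Fin n) (g : A → Fin n′) →
  (∀ {a b} → f a ≡ f b → a ≡ b) → (∀ {a b} → f a F.< f b → g a F.< g b) →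
  ∀ {a b} → g a F.< g b → f a F.< f b
<-reflected f g f-injective f<⇒g< {a} {b} ga<gb with Fin.<-cmp (f a) (f b)
... | tri< fa<fb _ _ = fa<fb
... | tri≈ _ fa≡fb _ = ⊥-elim (<-irrefl (cong (toℕ ∘ g) (f-injective fa≡fb)) ga<gb)
... | tri> _ _ fb<fa = ⊥-elim (<-asym ga<gb (f<⇒g< fb<fa))

module GridPattern {k n} {π : Perm k} (π≼σ : π ≼ gridPerm n) where

  private
    s : ℕ
    s = ⌊√ n ⌋
    e : Fin k → Fin n
    e = proj₁ π≼σ

  occupied? : ∀ p → Dec (∃ λ x → toℕ (e x) ≡ p)
  occupied? p = Fin.any? λ x → toℕ (e x) ≟ p

  occupied : ℕ → Bool
  occupied p = ⌊ occupied? p ⌋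

  -- The bounds keep occurrences of τ inside the grid, where σₙ transposes.
  trace : Matrix
  trace i j = (i <ᵇ s) ∧ (j <ᵇ s) ∧ occupied (i * s + j)

  trace-cell : ∀ {i j} → i < s → j < s → trace i j ≡ occupied (i * s + j)
  trace-cell i<s j<s rewrite to T-≡ (<⇒<ᵇ i<s) | to T-≡ (<⇒<ᵇ j<s) = refl

  trace-witness : ∀ {i j} → T (trace i j) → i < s × j < s × ∃ λ x → toℕ (e x) ≡ i * s + j
  trace-witness {i} {j} hitⁱʲ =
    let i<ᵇs , rest  = to T-∧ hitⁱʲ
        j<ᵇs , occᵢⱼ = to T-∧ rest
    in  <ᵇ⇒< i s i<ᵇs , <ᵇ⇒< j s j<ᵇs , toWitness occᵢⱼ

  k≤weight-trace : k ≤ weight s trace + (s + s)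
  k≤weight-trace = begin
    k
      ≤⟨ k≤count-occupied ⟩
    count n occupied
      ≡⟨ cong (λ n′ → count n′ occupied) (m+[n∸m]≡n (⌊√n⌋²≤n n)) ⟨
    count (s * s + (n ∸ s * s)) occupied
      ≡⟨ ∑-+ (s * s) (n ∸ s * s) ⟩
    count (s * s) occupied + count (n ∸ s * s) (occupied ∘ (s * s +_))
      ≤⟨ +-mono-≤ (≤-reflexive grid) (count≤n _ _) ⟩
    weight s trace + (n ∸ s * s)
      ≤⟨ +-monoʳ-≤ (weight s trace) (n∸⌊√n⌋²≤2⌊√n⌋ n) ⟩
    weight s trace + (s + s)
      ∎
    where
    open ≤-Reasoning
    k≤count-occupied : k ≤ count n occupied
    k≤count-occupied = Selection⇒≤count k n occupied record
      { point = toℕ ∘ e ; increasing = proj₁ (proj₂ π≼σ) _ _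
      ; bounded = toℕ<n ∘ e ; holds = λ x → fromWitness (x , refl) }
    grid : count (s * s) occupied ≡ weight s trace
    grid = trans (∑-* s s) (∑-cong s λ i<s → ∑-cong s λ j<s → cong 𝟙 (sym (trace-cell i<s j<s)))

  Contains-trace⇒≼ : ∀ {m} {τ : Perm m} → Contains τ trace → τ ≼ π
  Contains-trace⇒≼ {m} {τ} occ = x , (λ i j → x-increasing {i} {j}) , x-values
    where
    cell : ∀ l → row occ l < s × col occ (τ ⟨$⟩ʳ l) < s ×
                 ∃ λ y → toℕ (e y) ≡ row occ l * s + col occ (τ ⟨$⟩ʳ l)
    cell l = trace-witness (hit occ l)
    x : Fin m → Fin k
    x l = proj₁ (proj₂ (proj₂ (cell l)))
    e∘x : ∀ l → toℕ (e (x l)) ≡ row occ l * s + col occ (τ ⟨$⟩ʳ l)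
    e∘x l = proj₂ (proj₂ (proj₂ (cell l)))
    σ∘e∘x : ∀ l → toℕ (gridPerm n ⟨$⟩ʳ e (x l)) ≡ col occ (τ ⟨$⟩ʳ l) * s + row occ l
    σ∘e∘x l = begin
      toℕ (gridPerm n ⟨$⟩ʳ e (x l))                        ≡⟨ toℕ-gridPerm n (e (x l)) ⟩
      gridTranspose s (toℕ (e (x l)))                      ≡⟨ cong (gridTranspose s) (e∘x l) ⟩
      gridTranspose s (row occ l * s + col occ (τ ⟨$⟩ʳ l))  ≡⟨ gridTranspose-cell (proj₁ (cell l))
                                                                                (proj₁ (proj₂ (cell l))) ⟩
      col occ (τ ⟨$⟩ʳ l) * s + row occ l                    ∎
      where open ≡-Reasoning
    x-increasing : ∀ {i j} → i F.< j → x i F.< x j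
    x-increasing {i} {j} i<j = <-reflected (λ y → y) e (λ eq → eq) (proj₁ (proj₂ π≼σ) _ _)
      (subst₂ _<_ (sym (e∘x i)) (sym (e∘x j)) (lex-< s (row-increasing occ i<j) (proj₁ (proj₂ (cell i)))))
    x-values : ∀ a b → τ ⟨$⟩ʳ a F.< τ ⟨$⟩ʳ b → π ⟨$⟩ʳ x a F.< π ⟨$⟩ʳ x b
    x-values a b τa<τb =
      <-reflected (π ⟨$⟩ʳ_) (λ y → gridPerm n ⟨$⟩ʳ e y) (Injection.injective (↔⇒↣ π))
        (proj₂ (proj₂ π≼σ) _ _)
        (subst₂ _<_ (sym (σ∘e∘x a)) (sym (σ∘e∘x b)) (lex-< s (col-increasing occ τa<τb) (proj₁ (cell a))))

gridPerm-pattern-length : ∀ {m} (τ : Perm m) →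
  ∃ λ D → ∀ {k n} (π : Perm k) → Avoids π τ → π ≼ gridPerm n → k ≤ D * ⌊√ n ⌋
gridPerm-pattern-length {zero}  τ = 0 , λ _ π⊉τ _ → ⊥-elim (π⊉τ ((λ ()) , (λ ()) , (λ ())))
gridPerm-pattern-length {suc m} τ = K * t + 2 , length≤
  where
  open MarcusTardos τ
  length≤ : ∀ {k n} (π : Perm k) → Avoids π τ → π ≼ gridPerm n → k ≤ (K * t + 2) * ⌊√ n ⌋
  length≤ {k} {n} π π⊉τ π≼σ = begin
    k                         ≤⟨ k≤weight-trace ⟩
    weight s trace + (s + s)  ≤⟨ +-monoˡ-≤ (s + s) (marcus-tardos s trace (π⊉τ ∘′ Contains-trace⇒≼)) ⟩
    K * t * s + (s + s)       ≡⟨ distrib (K * t) s ⟩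
    (K * t + 2) * s           ∎
    where
    open ≤-Reasoning
    open GridPattern {k} {n} {π} π≼σ
    s : ℕ
    s = ⌊√ n ⌋
    distrib : ∀ c s → c * s + (s + s) ≡ (c + 2) * s
    distrib = solve-∀

^-distribʳ-* : ∀ m n o → (m * n) ^ o ≡ m ^ o * n ^ o
^-distribʳ-* m n zero    = refl
^-distribʳ-* m n (suc o) = trans (cong (m * n *_) (^-distribʳ-* m n o)) (*-interchange m n (m ^ o) (n ^ o))

[m*m]^n≡m^[2*n] : ∀ m n → (m * m) ^ n ≡ m ^ (2 * n)
[m*m]^n≡m^[2*n] m n = trans (cong (λ x → (m * x) ^ n) (sym (*-identityʳ m))) (^-*-assoc m 2 n)

O[√n]⇒o[n^[1/2+p/q]] : ∀ p q a b D s {k n} → 1 ≤ p → 1 ≤ a →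
  k ≤ D * s → s * s ≤ n → (b * D) ^ (2 * q) < n →
  b ^ (2 * q) * k ^ (2 * q) < a ^ (2 * q) * n ^ (q + 2 * p)
O[√n]⇒o[n^[1/2+p/q]] p q a b D s {k} {n} p≥1 a≥1 k≤Ds s²≤n n-large = begin-strict
  b ^ (2 * q) * k ^ (2 * q)                  ≤⟨ *-monoʳ-≤ (b ^ (2 * q)) (^-monoˡ-≤ (2 * q) k≤Ds) ⟩
  b ^ (2 * q) * (D * s) ^ (2 * q)            ≡⟨ cong (b ^ (2 * q) *_) (^-distribʳ-* D s (2 * q)) ⟩
  b ^ (2 * q) * (D ^ (2 * q) * s ^ (2 * q))  ≡⟨ *-assoc (b ^ (2 * q)) _ _ ⟨
  b ^ (2 * q) * D ^ (2 * q) * s ^ (2 * q)    ≡⟨ cong₂ _*_ (^-distribʳ-* b D (2 * q)) ([m*m]^n≡m^[2*n] s q) ⟨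
  (b * D) ^ (2 * q) * (s * s) ^ q            ≤⟨ *-monoʳ-≤ ((b * D) ^ (2 * q)) (^-monoˡ-≤ q s²≤n) ⟩
  (b * D) ^ (2 * q) * n ^ q                  <⟨ *-monoˡ-< (n ^ q) {{m^n≢0 n q}} n-large ⟩
  n ^ suc q                                  ≤⟨ ^-monoʳ-≤ n 1+q≤q+2p ⟩
  n ^ (q + 2 * p)                            ≤⟨ m≤n*m (n ^ (q + 2 * p)) (a ^ (2 * q)) {{m^n≢0 a (2 * q)}} ⟩
  a ^ (2 * q) * n ^ (q + 2 * p)              ∎
  where
  open ≤-Reasoning
  instance
    a≢0 : NonZero a
    a≢0 = >-nonZero a≥1
    n≢0 : NonZero n
    n≢0 = >-nonZero (≤-<-trans z≤n n-large)
  1+q≤q+2p : suc q ≤ q + 2 * p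
  1+q≤q+2p = subst (_≤ q + 2 * p) (+-comm q 1) (+-monoʳ-≤ q (≤-trans p≥1 (m≤m+n p _)))

theorem3 : (p q : ℕ) → p ≥ 1 → q ≥ 1 →
    (τs : List Pattern) → τs ≢ [] →
    Σ ((n : ℕ) → Perm n) λ σ →
    (a b : ℕ) → a ≥ 1 → b ≥ 1 →
    ∃ λ N → (n : ℕ) → N ≤ n →
    (k : ℕ) (π : Perm k) → InClass τs π → π ≼ σ n →
    b ^ (2 * q) * k ^ (2 * q) < a ^ (2 * q) * n ^ (q + 2 * p)
theorem3 p q p≥1 _ []            τs≢[] = ⊥-elim (τs≢[] refl)
theorem3 p q p≥1 _ ((_ , τ) ∷ _) _     = gridPerm , λ a b a≥1 _ →
  let D , length≤D√n = gridPerm-pattern-length τ in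
  suc ((b * D) ^ (2 * q)) , λ { n n-large k π (π⊉τ ∷ _) π≼σ →
    O[√n]⇒o[n^[1/2+p/q]] p q a b D ⌊√ n ⌋ p≥1 a≥1
      (length≤D√n π π⊉τ π≼σ) (⌊√n⌋²≤n n) n-large }
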